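{- Let $s\ge 0$ be an integer and let $n=3^{6s+5}+1$ or $n=3^{6s+5}+2$; put $k=\lceil\log_3 n\rceil$. Let $m$ be an integer with $n\le m<3^k<3n$, and suppose that $m=3^{r}\cdot 7$ with $r\ge 0$ an integer. Then the integers $a^3+a$ $(1\le a\le n)$ are pairwise distinct modulo $m$.
   Context: $\lceil x\rceil$ denotes the smallest integer no less than $x$. -}

module Defs where

open import Data.Nat using (ℕ; _≤_; _^_)

-- k = ⌈log₃ n⌉ : the smallest natural number k with n ≤ 3^k
-- (for n ≥ 1, ⌈log₃ n⌉ is the least integer k with log₃ n ≤ k, i.e. n ≤ 3^k)
IsCeilLog3 : ℕ → ℕ → Set
IsCeilLog3 n k = (n ≤ 3 ^ k) × ((j : ℕ) → n ≤ 3 ^ j → k ≤ j)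
  where open import Data.Product using (_×_)

module Submission where

-- Put X = 3^(6s+4) and f x = x³ + x. Then n ∈ {3X + 1, 3X + 2}, X ≡ 4 (mod 7), and
-- n ≤ m < 3n forces m = 7X. For b < a ≤ n and d = a − b we have f a − f b = d · Q with
-- Q = 3b² + 3bd + d² + 1, which is never divisible by 3; so 7X ∣ f a − f b forces X ∣ d,
-- i.e. d = tX with 1 ≤ t ≤ 3, and then 7 ∣ d · Q. Mod 7 we have d ≡ 4t, and a residue
-- table shows that this is only possible when t = 3 and b mod 7 ≥ 3, whereas t = 3
-- means d = 3X and hence b ≤ 2.

open import Defs
open import Data.Nat
open import Data.Nat.Properties
open import Data.Nat.DivMod
open import Data.Nat.Divisibility
open import Data.Nat.Primality
open import Data.Nat.Tactic.RingSolver using (solve-∀)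
open import Data.Product using (_×_; _,_; proj₁; proj₂)
open import Data.Sum using (_⊎_; inj₁; inj₂)
open import Data.Empty using (⊥-elim)
open import Function using (_∘_)
open import Relation.Nullary using (¬_)
open import Relation.Nullary.Decidable using (from-yes)
open import Relation.Binary.PropositionalEquality
open import Relation.Binary.Definitions using (tri<; tri≈; tri>)

%-cong-+ : ∀ n .{{_ : NonZero n}} a a' b b' →
  a % n ≡ a' % n → b % n ≡ b' % n → (a + b) % n ≡ (a' + b') % n
%-cong-+ n a a' b b' p q = begin
  (a + b) % n               ≡⟨ %-distribˡ-+ a b n ⟩
  (a % n + b % n) % n       ≡⟨ cong₂ (λ x y → (x + y) % n) p q ⟩
  (a' % n + b' % n) % n     ≡⟨ %-distribˡ-+ a' b' n ⟨
  (a' + b') % n             ∎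
  where open ≡-Reasoning

%-cong-* : ∀ n .{{_ : NonZero n}} a a' b b' →
  a % n ≡ a' % n → b % n ≡ b' % n → (a * b) % n ≡ (a' * b') % n
%-cong-* n a a' b b' p q = begin
  (a * b) % n               ≡⟨ %-distribˡ-* a b n ⟩
  (a % n * (b % n)) % n     ≡⟨ cong₂ (λ x y → (x * y) % n) p q ⟩
  (a' % n * (b' % n)) % n   ≡⟨ %-distribˡ-* a' b' n ⟨
  (a' * b') % n             ∎
  where open ≡-Reasoning

%≡%⇒∣∸ : ∀ n .{{_ : NonZero n}} x y → x % n ≡ y % n → n ∣ x ∸ y
%≡%⇒∣∸ n x y eq = divides (x / n ∸ y / n) (begin
  x ∸ y                                       ≡⟨ cong₂ _∸_ (m≡m%n+[m/n]*n x n) (m≡m%n+[m/n]*n y n) ⟩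
  (x % n + x / n * n) ∸ (y % n + y / n * n)   ≡⟨ cong (λ r → (x % n + x / n * n) ∸ (r + y / n * n)) eq ⟨
  (x % n + x / n * n) ∸ (x % n + y / n * n)   ≡⟨ [m+n]∸[m+o]≡n∸o (x % n) _ _ ⟩
  x / n * n ∸ y / n * n                       ≡⟨ *-distribʳ-∸ n (x / n) (y / n) ⟨
  (x / n ∸ y / n) * n                         ∎)
  where open ≡-Reasoning

^-cancelʳ-< : ∀ m .{{_ : NonZero m}} {i j} → m ^ i < m ^ j → i < j
^-cancelʳ-< m mⁱ<mʲ = ≰⇒> (λ j≤i → <⇒≱ mⁱ<mʲ (^-monoʳ-≤ m j≤i))

p^k∣n*q⇒p^k∣n : ∀ {p q} → Prime p → ¬ p ∣ q → ∀ k n → p ^ k ∣ n * q → p ^ k ∣ n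
p^k∣n*q⇒p^k∣n _ _ zero n _ = 1∣ n
p^k∣n*q⇒p^k∣n {p} {q} p-prime p∤q (suc k) n p^[1+k]∣nq
  with euclidsLemma n q p-prime (∣-trans (m∣m*n (p ^ k)) p^[1+k]∣nq)
... | inj₂ p∣q = ⊥-elim (p∤q p∣q)
... | inj₁ (divides c refl) =
  subst (p ^ suc k ∣_) (*-comm p c) (*-monoʳ-∣ p (p^k∣n*q⇒p^k∣n p-prime p∤q k c p^k∣cq))
  where
  instance
    p≢0 : NonZero p
    p≢0 = prime⇒nonZero p-prime
  p^k∣cq : p ^ k ∣ c * q
  p^k∣cq = *-cancelˡ-∣ p (subst (p ^ suc k ∣_) (trans (cong (_* q) (*-comm c p)) (*-assoc p c q)) p^[1+k]∣nq)

diffQuot : ℕ → ℕ → ℕ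
diffQuot b d = 3 * (b * b) + 3 * (b * d) + d * d + 1

cube+id-split : ∀ b d → (b + d) ^ 3 + (b + d) ≡ (b ^ 3 + b) + d * diffQuot b d
cube+id-split = expanded
  where
  expanded : ∀ b d → (b + d) * ((b + d) * ((b + d) * 1)) + (b + d)
                   ≡ (b * (b * (b * 1)) + b) + d * (3 * (b * b) + 3 * (b * d) + d * d + 1)
  expanded = solve-∀

diffQuot-cong% : ∀ n .{{_ : NonZero n}} b b' d d' →
  b % n ≡ b' % n → d % n ≡ d' % n → diffQuot b d % n ≡ diffQuot b' d' % n
diffQuot-cong% n b b' d d' p q =
  %-cong-+ n _ _ 1 1 (%-cong-+ n _ _ _ _ (%-cong-+ n _ _ _ _ (3* (%-cong-* n _ _ _ _ p p))
    (3* (%-cong-* n _ _ _ _ p q))) (%-cong-* n _ _ _ _ q q)) refl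
  where
  3* : ∀ {x x'} → x % n ≡ x' % n → (3 * x) % n ≡ (3 * x') % n
  3* = %-cong-* n 3 3 _ _ refl

diffQuot-mod : ∀ n .{{_ : NonZero n}} b d → diffQuot b d % n ≡ diffQuot (b % n) (d % n) % n
diffQuot-mod n b d = diffQuot-cong% n b (b % n) d (d % n) (sym (m%n%n≡m%n b n)) (sym (m%n%n≡m%n d n))

3∤diffQuot : ∀ b d → ¬ 3 ∣ diffQuot b d
3∤diffQuot b d 3∣Q = residues (b % 3) (d % 3) (m%n<n b 3) (m%n<n d 3)
  (trans (sym (diffQuot-mod 3 b d)) (n∣m⇒m%n≡0 _ 3 3∣Q))
  where
  residues : ∀ u v → u < 3 → v < 3 → diffQuot u v % 3 ≢ 0
  residues 0 0 _ _ ()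
  residues 0 1 _ _ ()
  residues 0 2 _ _ ()
  residues 1 0 _ _ ()
  residues 1 1 _ _ ()
  residues 1 2 _ _ ()
  residues 2 0 _ _ ()
  residues 2 1 _ _ ()
  residues 2 2 _ _ ()
  residues (suc (suc (suc _))) _ (s≤s (s≤s (s≤s ()))) _
  residues _ (suc (suc (suc _))) _ (s≤s (s≤s (s≤s ())))

7∣t4*diffQuot⇒t≡3 : ∀ t u → 1 ≤ t → t ≤ 3 → u < 7 →
  (t * 4 * diffQuot u (t * 4)) % 7 ≡ 0 → t ≡ 3 × 3 ≤ u
7∣t4*diffQuot⇒t≡3 1 0 _ _ _ ()
7∣t4*diffQuot⇒t≡3 1 1 _ _ _ ()
7∣t4*diffQuot⇒t≡3 1 2 _ _ _ ()
7∣t4*diffQuot⇒t≡3 1 3 _ _ _ ()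
7∣t4*diffQuot⇒t≡3 1 4 _ _ _ ()
7∣t4*diffQuot⇒t≡3 1 5 _ _ _ ()
7∣t4*diffQuot⇒t≡3 1 6 _ _ _ ()
7∣t4*diffQuot⇒t≡3 2 0 _ _ _ ()
7∣t4*diffQuot⇒t≡3 2 1 _ _ _ ()
7∣t4*diffQuot⇒t≡3 2 2 _ _ _ ()
7∣t4*diffQuot⇒t≡3 2 3 _ _ _ ()
7∣t4*diffQuot⇒t≡3 2 4 _ _ _ ()
7∣t4*diffQuot⇒t≡3 2 5 _ _ _ ()
7∣t4*diffQuot⇒t≡3 2 6 _ _ _ ()
7∣t4*diffQuot⇒t≡3 3 0 _ _ _ ()
7∣t4*diffQuot⇒t≡3 3 1 _ _ _ ()
7∣t4*diffQuot⇒t≡3 3 2 _ _ _ ()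
7∣t4*diffQuot⇒t≡3 3 3 _ _ _ _ = refl , s≤s (s≤s (s≤s z≤n))
7∣t4*diffQuot⇒t≡3 3 4 _ _ _ ()
7∣t4*diffQuot⇒t≡3 3 5 _ _ _ ()
7∣t4*diffQuot⇒t≡3 3 6 _ _ _ _ = refl , s≤s (s≤s (s≤s z≤n))
7∣t4*diffQuot⇒t≡3 (suc (suc (suc (suc _)))) _ _ (s≤s (s≤s (s≤s ()))) _ _
7∣t4*diffQuot⇒t≡3 (suc _) (suc (suc (suc (suc (suc (suc (suc _))))))) _ _
  (s≤s (s≤s (s≤s (s≤s (s≤s (s≤s (s≤s ()))))))) _

7∤t3^R*diffQuot : ∀ R b t → 3 ^ R % 7 ≡ 4 → 2 ≤ 3 ^ R → 1 ≤ b → 1 ≤ t * 3 ^ R →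
  b + t * 3 ^ R ≤ 3 * 3 ^ R + 2 → ¬ 7 ∣ t * 3 ^ R * diffQuot b (t * 3 ^ R)
7∤t3^R*diffQuot R b t X%7≡4 2≤X 1≤b 1≤d b+d≤3X+2 7∣dQ =
  excluded (7∣t4*diffQuot⇒t≡3 t (b % 7) 1≤t t≤3 (m%n<n b 7) residue≡0)
  where
  X : ℕ
  X = 3 ^ R
  d : ℕ
  d = t * X
  1≤t : 1 ≤ t
  1≤t = *-cancelʳ-< X 0 t 1≤d
  d<4X : d < 4 * X
  d<4X = begin-strict
    d             <⟨ +-monoˡ-≤ d 1≤b ⟩
    b + d         ≤⟨ b+d≤3X+2 ⟩
    3 * X + 2     ≤⟨ +-monoʳ-≤ (3 * X) 2≤X ⟩
    3 * X + X     ≡⟨ +-comm (3 * X) X ⟩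
    4 * X         ∎
    where open ≤-Reasoning
  t≤3 : t ≤ 3
  t≤3 = s≤s⁻¹ (*-cancelʳ-< X t 4 d<4X)
  residue≡0 : (t * 4 * diffQuot (b % 7) (t * 4)) % 7 ≡ 0
  residue≡0 = begin
    (t * 4 * diffQuot (b % 7) (t * 4)) % 7   ≡⟨ %-cong-* 7 d (t * 4) (diffQuot b d) _ d≡4t (diffQuot-cong% 7 b (b % 7) d (t * 4) b≡b%7 d≡4t) ⟨
    (d * diffQuot b d) % 7                   ≡⟨ n∣m⇒m%n≡0 _ 7 7∣dQ ⟩
    0                                        ∎
    where
    open ≡-Reasoning
    d≡4t : d % 7 ≡ (t * 4) % 7
    d≡4t = %-cong-* 7 t t X 4 refl X%7≡4
    b≡b%7 : b % 7 ≡ (b % 7) % 7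
    b≡b%7 = sym (m%n%n≡m%n b 7)
  excluded : ¬ (t ≡ 3 × 3 ≤ b % 7)
  excluded (t≡3 , 3≤b%7) = <⇒≱ (s≤s (s≤s (s≤s z≤n))) (≤-trans 3≤b%7 (≤-trans (m%n≤m b 7) b≤2))
    where
    b≤2 : b ≤ 2
    b≤2 = +-cancelʳ-≤ (3 * X) b 2 (begin
      b + 3 * X   ≡⟨ cong (λ c → b + c * X) t≡3 ⟨
      b + d       ≤⟨ b+d≤3X+2 ⟩
      3 * X + 2   ≡⟨ +-comm (3 * X) 2 ⟩
      2 + 3 * X   ∎)
      where open ≤-Reasoning

7·3^R∤d*diffQuot : ∀ R b d → 3 ^ R % 7 ≡ 4 → 2 ≤ 3 ^ R → 1 ≤ b → 1 ≤ d → b + d ≤ 3 * 3 ^ R + 2 →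
  ¬ 3 ^ R * 7 ∣ d * diffQuot b d
7·3^R∤d*diffQuot R b d X%7≡4 2≤X 1≤b 1≤d b+d≤3X+2 7X∣dQ
  with divides t refl ← p^k∣n*q⇒p^k∣n (from-yes (prime? 3)) (3∤diffQuot b d) R d (∣-trans (m∣m*n 7) 7X∣dQ)
  = 7∤t3^R*diffQuot R b t X%7≡4 2≤X 1≤b 1≤d b+d≤3X+2 (∣-trans (n∣m*n (3 ^ R)) 7X∣dQ)

collision⇒∣ : ∀ m .{{_ : NonZero m}} b d →
  ((b + d) ^ 3 + (b + d)) % m ≡ (b ^ 3 + b) % m → m ∣ d * diffQuot b d
collision⇒∣ m b d eq = subst (m ∣_) difference≡ (%≡%⇒∣∸ m _ _ eq)
  where
  open ≡-Reasoning
  difference≡ : (b + d) ^ 3 + (b + d) ∸ (b ^ 3 + b) ≡ d * diffQuot b d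
  difference≡ = begin
    (b + d) ^ 3 + (b + d) ∸ (b ^ 3 + b)                ≡⟨ cong (_∸ (b ^ 3 + b)) (cube+id-split b d) ⟩
    (b ^ 3 + b) + d * diffQuot b d ∸ (b ^ 3 + b)       ≡⟨ m+n∸m≡n (b ^ 3 + b) _ ⟩
    d * diffQuot b d                                   ∎

noCollision : ∀ R m .{{_ : NonZero m}} → m ≡ 3 ^ R * 7 → 3 ^ R % 7 ≡ 4 → 2 ≤ 3 ^ R →
  ∀ {a b} → b < a → 1 ≤ b → a ≤ 3 * 3 ^ R + 2 → (a ^ 3 + a) % m ≢ (b ^ 3 + b) % m
noCollision R m m≡7X X%7≡4 2≤X {a} {b} b<a 1≤b a≤3X+2 eq =
  7·3^R∤d*diffQuot R b d X%7≡4 2≤X 1≤b (m<n⇒0<n∸m b<a) (subst (_≤ 3 * 3 ^ R + 2) (sym b+d≡a) a≤3X+2)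
    (subst (_∣ d * diffQuot b d) m≡7X (collision⇒∣ m b d (subst (λ x → (x ^ 3 + x) % m ≡ _) (sym b+d≡a) eq)))
  where
  d : ℕ
  d = a ∸ b
  b+d≡a : b + d ≡ a
  b+d≡a = m+[n∸m]≡n (<⇒≤ b<a)

cube+id-injective-mod : ∀ R m .{{_ : NonZero m}} → m ≡ 3 ^ R * 7 → 3 ^ R % 7 ≡ 4 → 2 ≤ 3 ^ R →
  ∀ a b → 1 ≤ a → a ≤ 3 * 3 ^ R + 2 → 1 ≤ b → b ≤ 3 * 3 ^ R + 2 →
  (a ^ 3 + a) % m ≡ (b ^ 3 + b) % m → a ≡ b
cube+id-injective-mod R m m≡7X X%7≡4 2≤X a b 1≤a a≤3X+2 1≤b b≤3X+2 eq with <-cmp a b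
... | tri< a<b _ _ = ⊥-elim (noCollision R m m≡7X X%7≡4 2≤X a<b 1≤a b≤3X+2 (sym eq))
... | tri≈ _ a≡b _ = a≡b
... | tri> _ _ b<a = ⊥-elim (noCollision R m m≡7X X%7≡4 2≤X b<a 1≤b a≤3X+2 eq)

3*[3x+2]≤3x*7 : ∀ x → 1 ≤ x → 3 * (3 * x + 2) ≤ 3 * x * 7
3*[3x+2]≤3x*7 (suc y) _ = subst (3 * (3 * suc y + 2) ≤_) (sym (expand y)) (m≤m+n _ _)
  where
  expand : ∀ y → 3 * suc y * 7 ≡ 3 * (3 * suc y + 2) + (12 * y + 6)
  expand = solve-∀

-- 7 · 3^r lies strictly between 3^(R+1) and 7 · 3^(R+1).
exponent-unique : ∀ R r n → 3 * 3 ^ R < n → n ≤ 3 * 3 ^ R + 2 → n ≤ 3 ^ r * 7 → 3 ^ r * 7 < 3 * n → r ≡ R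
exponent-unique R r n 3X<n n≤3X+2 n≤7Y 7Y<3n = ≤-antisym r≤R R≤r
  where
  X : ℕ
  X = 3 ^ R
  Y : ℕ
  Y = 3 ^ r
  R≤r : R ≤ r
  R≤r = s≤s⁻¹ (s≤s⁻¹ (^-cancelʳ-< 3 (begin-strict
    3 * X             <⟨ 3X<n ⟩
    n                 ≤⟨ n≤7Y ⟩
    Y * 7             ≤⟨ *-monoʳ-≤ Y (m≤m+n 7 2) ⟩
    Y * 9             ≡⟨ nine Y ⟩
    3 * (3 * Y)       ∎)))
    where
    open ≤-Reasoning
    nine : ∀ y → y * 9 ≡ 3 * (3 * y)
    nine = solve-∀
  r≤R : r ≤ R
  r≤R = s≤s⁻¹ (^-cancelʳ-< 3 (*-cancelʳ-< 7 Y (3 * X) (begin-strict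
    Y * 7             <⟨ 7Y<3n ⟩
    3 * n             ≤⟨ *-monoʳ-≤ 3 n≤3X+2 ⟩
    3 * (3 * X + 2)   ≤⟨ 3*[3x+2]≤3x*7 X (m^n>0 3 R) ⟩
    3 * X * 7         ∎)))
    where open ≤-Reasoning

3^[6s+4]≡81*729^s : ∀ s → 3 ^ (6 * s + 4) ≡ 81 * 729 ^ s
3^[6s+4]≡81*729^s s = begin
  3 ^ (6 * s + 4)       ≡⟨ ^-distribˡ-+-* 3 (6 * s) 4 ⟩
  3 ^ (6 * s) * 81      ≡⟨ *-comm (3 ^ (6 * s)) 81 ⟩
  81 * 3 ^ (6 * s)      ≡⟨ cong (81 *_) (^-*-assoc 3 6 s) ⟨
  81 * 729 ^ s          ∎
  where open ≡-Reasoning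

729^s%7≡1 : ∀ s → 729 ^ s % 7 ≡ 1
729^s%7≡1 zero = refl
729^s%7≡1 (suc s) = %-cong-* 7 729 1 (729 ^ s) 1 refl (729^s%7≡1 s)

3^[6s+4]%7≡4 : ∀ s → 3 ^ (6 * s + 4) % 7 ≡ 4
3^[6s+4]%7≡4 s = trans (cong (_% 7) (3^[6s+4]≡81*729^s s)) (%-cong-* 7 81 81 (729 ^ s) 1 refl (729^s%7≡1 s))

2≤3^[6s+4] : ∀ s → 2 ≤ 3 ^ (6 * s + 4)
2≤3^[6s+4] s = ≤-trans (n≤1+n 2) (^-monoʳ-≤ 3 (≤-trans (s≤s z≤n) (m≤n+m 4 (6 * s))))

just-above-3^[1+R] : ∀ R n → (n ≡ 3 ^ suc R + 1 ⊎ n ≡ 3 ^ suc R + 2) → 3 * 3 ^ R < n × n ≤ 3 * 3 ^ R + 2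
just-above-3^[1+R] R n (inj₁ refl) = m<m+n (3 * 3 ^ R) (s≤s z≤n) , +-monoʳ-≤ (3 * 3 ^ R) (s≤s z≤n)
just-above-3^[1+R] R n (inj₂ refl) = m<m+n (3 * 3 ^ R) (s≤s z≤n) , ≤-refl

lemma5p5 : (s n k m r : ℕ) →
    (n ≡ 3 ^ (6 * s + 5) + 1 ⊎ n ≡ 3 ^ (6 * s + 5) + 2) →
    IsCeilLog3 n k →
    n ≤ m → m < 3 ^ k → 3 ^ k < 3 * n →
    m ≡ 3 ^ r * 7 →
    .{{_ : NonZero m}} →
    (a b : ℕ) → 1 ≤ a → a ≤ n → 1 ≤ b → b ≤ n → a ≢ b →
    (a ^ 3 + a) % m ≢ (b ^ 3 + b) % m
lemma5p5 s n k m r n≡ _ n≤m m<3ᵏ 3ᵏ<3n m≡7·3^r a b 1≤a a≤n 1≤b b≤n a≢b =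
  a≢b ∘ cube+id-injective-mod R m m≡7X (3^[6s+4]%7≡4 s) (2≤3^[6s+4] s)
          a b 1≤a (≤-trans a≤n n≤3X+2) 1≤b (≤-trans b≤n n≤3X+2)
  where
  R : ℕ
  R = 6 * s + 4
  bounds : 3 * 3 ^ R < n × n ≤ 3 * 3 ^ R + 2
  bounds = just-above-3^[1+R] R n (subst (λ e → n ≡ 3 ^ e + 1 ⊎ n ≡ 3 ^ e + 2) (+-suc (6 * s) 4) n≡)
  n≤3X+2 : n ≤ 3 * 3 ^ R + 2
  n≤3X+2 = proj₂ bounds
  r≡R : r ≡ R
  r≡R = exponent-unique R r n (proj₁ bounds) n≤3X+2 (subst (n ≤_) m≡7·3^r n≤m)
          (subst (_< 3 * n) m≡7·3^r (<-trans m<3ᵏ 3ᵏ<3n))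
  m≡7X : m ≡ 3 ^ R * 7
  m≡7X = trans m≡7·3^r (cong (λ e → 3 ^ e * 7) r≡R)
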